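{- Let $q$ be a prime power, $m,n$ positive integers, $f\in\mathbb{F}_q[X]$ monic irreducible of degree $mn$, $\alpha\in\mathbb{F}_{q^{mn}}$ a root of $f$, and $L_\alpha:\mathbb{F}_{q^{mn}}\to\mathbb{F}_{q^{mn}}$ the $\mathbb{F}_q$-linear map $x\mapsto\alpha x$. Call an ordered $\mathbb{F}_q$-basis of $\mathbb{F}_{q^{mn}}$ admissible if it has the form $(v_1,\dots,v_m,\alpha v_1,\dots,\alpha v_m,\dots,\alpha^{n-1}v_1,\dots,\alpha^{n-1}v_m)$ with $v_1,\dots,v_m\in\mathbb{F}_{q^{mn}}$. Then for every admissible basis $\mathcal{B}$ there are exactly $q^{mn}-1$ admissible bases $\mathcal{B}'$ such that the matrix of $L_\alpha$ with respect to $\mathcal{B}'$ equals the matrix of $L_\alpha$ with respect to $\mathcal{B}$. -}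

module Defs where

open import Level using (0ℓ)
open import Data.Nat using (ℕ; zero; suc; _∸_; _^_; _≤_)
open import Data.Nat.Primality using (Prime)
open import Data.Fin using (Fin; toℕ)
open import Data.Vec using (Vec; []; _∷_; lookup; zipWith; replicate; toList)
open import Data.List using (List; []; _∷_; _++_; [_])
open import Data.Product using (Σ; ∃; _×_; _,_; proj₁; proj₂)
open import Data.Sum using (_⊎_)
open import Function using (_∘_)
open import Relation.Nullary using (¬_)
open import Relation.Binary.PropositionalEquality using (_≡_; _≢_)
open import Algebra.Structures using (IsCommutativeRing)

IsPrimePower : ℕ → Set
IsPrimePower q = Σ ℕ λ p → Σ ℕ λ k → Prime p × q ≡ p ^ suc k

record Field : Set₁ where
  infixl 6 _+_
  infixl 7 _*_
  field
    Carrier : Set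
    _+_ _*_ : Carrier → Carrier → Carrier
    -_      : Carrier → Carrier
    0# 1#   : Carrier
    isCommutativeRing : IsCommutativeRing _≡_ _+_ _*_ -_ 0# 1#
    0≢1     : 0# ≢ 1#
    inverse : ∀ x → x ≢ 0# → ∃ λ y → x * y ≡ 1#

module _ (F : Field) where
  open Field F renaming (Carrier to K)

  -- Polynomials over K as coefficient lists (lowest degree first).
  Poly : Set
  Poly = List K

  coeff : Poly → ℕ → K
  coeff []      i       = 0#
  coeff (a ∷ p) zero    = a
  coeff (a ∷ p) (suc i) = coeff p i

  sumTo : ℕ → (ℕ → K) → K
  sumTo zero    g = 0#
  sumTo (suc n) g = sumTo n g + g n

  mulCoeff : Poly → Poly → ℕ → K
  mulCoeff g h i = sumTo (suc i) (λ j → coeff g j * coeff h (i ∸ j))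

  Constant : Poly → Set
  Constant g = ∀ i → coeff g (suc i) ≡ 0#

  Irreducible : Poly → Set
  Irreducible p = ¬ Constant p
                × (∀ g h → (∀ i → mulCoeff g h i ≡ coeff p i) → Constant g ⊎ Constant h)

  monicPoly : ∀ {d} → Vec K d → Poly
  monicPoly c = toList c ++ [ 1# ]

  -- The extension field K[X]/(f), f = monicPoly c of degree d,
  -- as K-vector space K^d (coordinates in the basis 1, α, …, α^{d-1},
  -- α = class of X, a root of f).
  Ext : ℕ → Set
  Ext d = Vec K d

  zeroE : ∀ {d} → Ext d
  zeroE = replicate _ 0#

  _⊕_ : ∀ {d} → Ext d → Ext d → Ext d
  x ⊕ y = zipWith _+_ x y

  _·_ : ∀ {d} → K → Ext d → Ext d
  a · x = Data.Vec.map (a *_) x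

  shiftIn : ∀ {d} → K → Vec K d → Vec K d × K
  shiftIn b []       = [] , b
  shiftIn b (a ∷ xs) = (b ∷ proj₁ (shiftIn a xs)) , proj₂ (shiftIn a xs)

  -- L_α : x ↦ α x   (using α^d = - Σ c_i α^i)
  mulα : ∀ {d} → Vec K d → Ext d → Ext d
  mulα c x = zipWith (λ y ci → y + - (proj₂ (shiftIn 0# x) * ci)) (proj₁ (shiftIn 0# x)) c

  iter : ∀ {A : Set} → ℕ → (A → A) → A → A
  iter zero    g x = x
  iter (suc k) g x = g (iter k g x)

  -- Admissible family (α^j v_i) indexed by (j , i) ∈ Fin n × Fin m,
  -- ordered lexicographically (j major, i minor).
  admissible : ∀ {d} (m n : ℕ) → Vec K d → Vec (Ext d) m → Fin n × Fin m → Ext d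
  admissible m n c v (j , i) = iter (toℕ j) (mulα c) (lookup v i)

  sumE : ∀ {d} (k : ℕ) → (Fin k → Ext d) → Ext d
  sumE zero    g = zeroE
  sumE (suc k) g = g Data.Fin.zero ⊕ sumE k (g ∘ Data.Fin.suc)

  lincomb : ∀ {d} (m n : ℕ) → (Fin n × Fin m → K) → (Fin n × Fin m → Ext d) → Ext d
  lincomb m n a b = sumE n (λ j → sumE m (λ i → a (j , i) · b (j , i)))

  record IsBasis {d} (m n : ℕ) (b : Fin n × Fin m → Ext d) : Set where
    field
      coord  : Ext d → Fin n × Fin m → K
      spans  : ∀ x → lincomb m n (coord x) b ≡ x
      unique : ∀ x a → lincomb m n a b ≡ x → ∀ k → a k ≡ coord x k

  matrix : ∀ {d m n} (c : Vec K d) {b : Fin n × Fin m → Ext d} →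
           IsBasis m n b → Fin n × Fin m → Fin n × Fin m → K
  matrix c {b} β k l = IsBasis.coord β (mulα c (b l)) k

-- Idea: if B′ = (α^j v′_i) has the same matrix as B = (α^j v_i), the linear map T
-- sending B to B′ commutes with α, so T is multiplication by the element γ = T 1, γ ≠ 0,
-- and v′ = γ v.  Conversely, for γ ≠ 0 the family γ B is again a basis (γ is invertible)
-- with the same matrix.  As v₁ ≠ 0 and E has no zero divisors, γ ↦ γ v is injective,
-- so the admissible v′ are counted by the q^d − 1 non-zero elements of E.
module Submission where

import Defs as D
open D using (Field; IsBasis; zeroE)
open import Data.Nat as ℕ using (ℕ; zero; suc; _∸_; z≤n; s≤s)
  renaming (_+_ to _+ℕ_; _≤_ to _≤ℕ_; _<_ to _<ℕ_)
import Data.Nat.Properties as ℕP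
open import Data.Fin as Fin using (Fin)
import Data.Fin.Properties as FinP
open import Data.Vec using (Vec; []; _∷_; lookup; zipWith; toList; map)
import Data.Vec.Properties as VP
open import Data.List as L using (List; _∷_; _++_; [_])
open import Data.List.Properties using (length-map; length-tabulate)
open import Data.List.Membership.Propositional using (_∈_)
open import Data.List.Membership.Propositional.Properties using (∈-map⁺; ∈-map⁻; ∈-allFin)
open import Data.List.Relation.Unary.Unique.Propositional using (Unique)
import Data.List.Relation.Unary.Unique.Propositional.Properties as UniqueP
open import Data.Product using (Σ; ∃; _×_; _,_; proj₁; proj₂)
open import Data.Product.Properties using (≡-dec)
open import Data.Sum using (inj₁; inj₂; [_,_]′)
open import Data.Empty using (⊥; ⊥-elim)
open import Relation.Nullary using (yes; no)
open import Relation.Nullary.Decidable using (via-injection)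
open import Relation.Binary.PropositionalEquality hiding ([_])
open import Relation.Binary.Definitions using (DecidableEquality)
open import Algebra.Structures using (IsCommutativeRing)
open import Algebra.Bundles using (CommutativeRing; CommutativeMonoid)
open import Function using (_∘_)
open import Function.Bundles using (_↔_; _⇔_; Inverse; mk↔ₛ′; mk⇔)
open import Function.Properties.Inverse using (↔⇒↣)

module Extension (𝔽 : Field) where
  open Field 𝔽 renaming (Carrier to K)
  open IsCommutativeRing isCommutativeRing
    using (+-assoc; +-comm; +-identityˡ; +-identityʳ; -‿inverseˡ; -‿inverseʳ;
           *-assoc; *-comm; *-identityˡ; *-identityʳ; distribˡ; distribʳ; zeroˡ; zeroʳ)

  ring : CommutativeRing _ _
  ring = record { isCommutativeRing = isCommutativeRing }

  open import Algebra.Properties.CommutativeSemigroup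
    (CommutativeMonoid.commutativeSemigroup (CommutativeRing.+-commutativeMonoid ring))
    using (interchange)
  open import Algebra.Properties.Ring (CommutativeRing.ring ring)
    using (-‿distribˡ-*; -‿distribʳ-*; -‿involutive; -0#≈0#; -‿+-comm; -1*x≈-x)
  open ≡-Reasoning

  minus-0* : ∀ x y → x + - (0# * y) ≡ x
  minus-0* x y = begin
    x + - (0# * y) ≡⟨ cong (λ z → x + - z) (zeroˡ y) ⟩
    x + - 0#       ≡⟨ cong (x +_) -0#≈0# ⟩
    x + 0#         ≡⟨ +-identityʳ x ⟩
    x              ∎

  -- The coefficient identity behind f = (X^(s+1) − h) · U, see `factorisation` below.
  negate-and-add : ∀ S F → (- 1#) * (S + - F) + S ≡ F
  negate-and-add S F = begin
    (- 1#) * (S + - F) + S   ≡⟨ cong (_+ S) (-1*x≈-x _) ⟩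
    - (S + - F) + S          ≡⟨ cong (_+ S) (sym (-‿+-comm S _)) ⟩
    (- S + - - F) + S        ≡⟨ cong (λ z → (- S + z) + S) (-‿involutive F) ⟩
    (- S + F) + S            ≡⟨ cong (_+ S) (+-comm (- S) F) ⟩
    (F + - S) + S            ≡⟨ +-assoc F (- S) S ⟩
    F + (- S + S)            ≡⟨ cong (F +_) (-‿inverseˡ S) ⟩
    F + 0#                   ≡⟨ +-identityʳ F ⟩
    F                        ∎

  0ᵛ : ∀ {k} → Vec K k
  0ᵛ = zeroE 𝔽

  _⊕_ : ∀ {k} → Vec K k → Vec K k → Vec K k
  _⊕_ = D._⊕_ 𝔽
  _·_ : ∀ {k} → K → Vec K k → Vec K k
  _·_ = D._·_ 𝔽
  infixl 6 _⊕_
  infixr 7 _·_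

  ⊖_ : ∀ {k} → Vec K k → Vec K k
  ⊖ x = (- 1#) · x

  ⊕-comm : ∀ {k} (x y : Vec K k) → x ⊕ y ≡ y ⊕ x
  ⊕-comm = VP.zipWith-comm +-comm

  ⊕-assoc : ∀ {k} (x y z : Vec K k) → (x ⊕ y) ⊕ z ≡ x ⊕ (y ⊕ z)
  ⊕-assoc = VP.zipWith-assoc +-assoc

  ⊕-identityˡ : ∀ {k} (x : Vec K k) → 0ᵛ ⊕ x ≡ x
  ⊕-identityˡ = VP.zipWith-identityˡ +-identityˡ

  ⊕-identityʳ : ∀ {k} (x : Vec K k) → x ⊕ 0ᵛ ≡ x
  ⊕-identityʳ = VP.zipWith-identityʳ +-identityʳ

  ⊕-interchange : ∀ {k} (x y z w : Vec K k) → (x ⊕ y) ⊕ (z ⊕ w) ≡ (x ⊕ z) ⊕ (y ⊕ w)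
  ⊕-interchange [] [] [] [] = refl
  ⊕-interchange (x ∷ xs) (y ∷ ys) (z ∷ zs) (w ∷ ws) =
    cong₂ _∷_ (interchange x y z w) (⊕-interchange xs ys zs ws)

  ·-distribˡ : ∀ {k} a (x y : Vec K k) → a · (x ⊕ y) ≡ a · x ⊕ a · y
  ·-distribˡ a [] [] = refl
  ·-distribˡ a (x ∷ xs) (y ∷ ys) = cong₂ _∷_ (distribˡ a x y) (·-distribˡ a xs ys)

  ·-distribʳ : ∀ {k} a b (x : Vec K k) → (a + b) · x ≡ a · x ⊕ b · x
  ·-distribʳ a b [] = refl
  ·-distribʳ a b (x ∷ xs) = cong₂ _∷_ (distribʳ x a b) (·-distribʳ a b xs)

  ·-assoc : ∀ {k} a b (x : Vec K k) → a · (b · x) ≡ (a * b) · x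
  ·-assoc a b [] = refl
  ·-assoc a b (x ∷ xs) = cong₂ _∷_ (sym (*-assoc a b x)) (·-assoc a b xs)

  ·-identity : ∀ {k} (x : Vec K k) → 1# · x ≡ x
  ·-identity [] = refl
  ·-identity (x ∷ xs) = cong₂ _∷_ (*-identityˡ x) (·-identity xs)

  ·-zeroˡ : ∀ {k} (x : Vec K k) → 0# · x ≡ 0ᵛ
  ·-zeroˡ [] = refl
  ·-zeroˡ (x ∷ xs) = cong₂ _∷_ (zeroˡ x) (·-zeroˡ xs)

  ·-zeroʳ : ∀ {k} a → a · 0ᵛ {k} ≡ 0ᵛ
  ·-zeroʳ {zero} a = refl
  ·-zeroʳ {suc k} a = cong₂ _∷_ (zeroʳ a) (·-zeroʳ a)

  ⊕-inverseʳ : ∀ {k} (x : Vec K k) → x ⊕ ⊖ x ≡ 0ᵛ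
  ⊕-inverseʳ [] = refl
  ⊕-inverseʳ (x ∷ xs) = cong₂ _∷_ x-x (⊕-inverseʳ xs)
    where
      x-x : x + (- 1#) * x ≡ 0#
      x-x = trans (cong (x +_) (-1*x≈-x x)) (-‿inverseʳ x)

  ⊕-cancelʳ : ∀ {k} (x x′ y : Vec K k) → x ⊕ y ≡ x′ ⊕ y → x ≡ x′
  ⊕-cancelʳ x x′ y e = begin
    x                   ≡⟨ sym (⊕-identityʳ x) ⟩
    x ⊕ 0ᵛ              ≡⟨ cong (x ⊕_) (sym (⊕-inverseʳ y)) ⟩
    x ⊕ (y ⊕ ⊖ y)       ≡⟨ sym (⊕-assoc x y _) ⟩
    (x ⊕ y) ⊕ ⊖ y       ≡⟨ cong (_⊕ ⊖ y) e ⟩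
    (x′ ⊕ y) ⊕ ⊖ y      ≡⟨ ⊕-assoc x′ y _ ⟩
    x′ ⊕ (y ⊕ ⊖ y)      ≡⟨ cong (x′ ⊕_) (⊕-inverseʳ y) ⟩
    x′ ⊕ 0ᵛ             ≡⟨ ⊕-identityʳ x′ ⟩
    x′                  ∎

  linear-0 : ∀ {k l} (T : Vec K k → Vec K l) → (∀ a x → T (a · x) ≡ a · T x) → T 0ᵛ ≡ 0ᵛ
  linear-0 T T-· = begin
    T 0ᵛ        ≡⟨ cong T (sym (·-zeroˡ 0ᵛ)) ⟩
    T (0# · 0ᵛ) ≡⟨ T-· 0# 0ᵛ ⟩
    0# · T 0ᵛ   ≡⟨ ·-zeroˡ _ ⟩
    0ᵛ          ∎

  -- Coefficient sequences.  A vector x ∈ K^k is read as the polynomial Σ x_i X^i,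
  -- i.e. as the sequence of its entries, which is 0 beyond position k.
  entry : ∀ {k} → Vec K k → ℕ → K
  entry x = D.coeff 𝔽 (toList x)

  entry-ext : ∀ {k} {x y : Vec K k} → (∀ j → entry x j ≡ entry y j) → x ≡ y
  entry-ext {x = []} {[]} h = refl
  entry-ext {x = a ∷ x} {b ∷ y} h = cong₂ _∷_ (h 0) (entry-ext (λ j → h (suc j)))

  entry-0ᵛ : ∀ {k} j → entry (0ᵛ {k}) j ≡ 0#
  entry-0ᵛ {zero} j = refl
  entry-0ᵛ {suc k} zero = refl
  entry-0ᵛ {suc k} (suc j) = entry-0ᵛ {k} j

  entry-⊕ : ∀ {k} (x y : Vec K k) j → entry (x ⊕ y) j ≡ entry x j + entry y j
  entry-⊕ [] [] j = sym (+-identityʳ 0#)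
  entry-⊕ (a ∷ x) (b ∷ y) zero = refl
  entry-⊕ (a ∷ x) (b ∷ y) (suc j) = entry-⊕ x y j

  entry-· : ∀ {k} a (x : Vec K k) j → entry (a · x) j ≡ a * entry x j
  entry-· a [] j = sym (zeroʳ a)
  entry-· a (b ∷ x) zero = refl
  entry-· a (b ∷ x) (suc j) = entry-· a x j

  DegreeBelow : ∀ {k} → Vec K k → ℕ → Set
  DegreeBelow x b = ∀ i → b ≤ℕ i → entry x i ≡ 0#

  entry-beyond : ∀ {k} (x : Vec K k) → DegreeBelow x k
  entry-beyond [] j _ = refl
  entry-beyond (a ∷ x) (suc j) (s≤s p) = entry-beyond x j p

  degree-lower : ∀ {k} (x : Vec K k) b → DegreeBelow x (suc b) → entry x b ≡ 0# → DegreeBelow x b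
  degree-lower x b deg xb≡0 i b≤i with ℕP.m≤n⇒m<n∨m≡n b≤i
  ... | inj₁ b<i = deg i b<i
  ... | inj₂ refl = xb≡0

  leading-coeff : ∀ {k} (s : Vec K k) t → D.coeff 𝔽 (toList s ++ [ t ]) k ≡ t
  leading-coeff [] t = refl
  leading-coeff (a ∷ s) t = leading-coeff s t

  monomial : ℕ → List K
  monomial k = D.monicPoly 𝔽 (0ᵛ {k})

  monomial-off : ∀ k t → t ≢ k → D.coeff 𝔽 (monomial k) t ≡ 0#
  monomial-off zero zero ne = ⊥-elim (ne refl)
  monomial-off zero (suc t) ne = refl
  monomial-off (suc k) zero ne = refl
  monomial-off (suc k) (suc t) ne = monomial-off k t (ne ∘ cong suc)

  monicPoly-split : ∀ {k} (v : Vec K k) t →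
                    D.coeff 𝔽 (D.monicPoly 𝔽 v) t ≡ entry v t + D.coeff 𝔽 (monomial k) t
  monicPoly-split [] zero = sym (+-identityˡ 1#)
  monicPoly-split [] (suc t) = sym (+-identityʳ 0#)
  monicPoly-split (b ∷ v) zero = sym (+-identityʳ b)
  monicPoly-split (b ∷ v) (suc t) = monicPoly-split v t

  Σ< : ℕ → (ℕ → K) → K
  Σ< = D.sumTo 𝔽

  Σ<-cong : ∀ n {g g′ : ℕ → K} → (∀ t → t <ℕ n → g t ≡ g′ t) → Σ< n g ≡ Σ< n g′
  Σ<-cong zero e = refl
  Σ<-cong (suc n) e = cong₂ _+_ (Σ<-cong n (λ t p → e t (ℕP.m≤n⇒m≤1+n p))) (e n ℕP.≤-refl)

  Σ<-front : ∀ n g → Σ< (suc n) g ≡ g 0 + Σ< n (g ∘ suc)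
  Σ<-front zero g = trans (+-identityˡ (g 0)) (sym (+-identityʳ (g 0)))
  Σ<-front (suc n) g = trans (cong (_+ g (suc n)) (Σ<-front n g)) (+-assoc _ _ _)

  Σ<-zero : ∀ n {g : ℕ → K} → (∀ t → t <ℕ n → g t ≡ 0#) → Σ< n g ≡ 0#
  Σ<-zero zero e = refl
  Σ<-zero (suc n) e =
    trans (cong₂ _+_ (Σ<-zero n (λ t p → e t (ℕP.m≤n⇒m≤1+n p))) (e n ℕP.≤-refl)) (+-identityʳ 0#)

  Σ<-extend : ∀ n {g : ℕ → K} → (∀ t → n ≤ℕ t → g t ≡ 0#) → ∀ e → Σ< (n +ℕ e) g ≡ Σ< n g
  Σ<-extend n z zero = cong (λ k → Σ< k _) (ℕP.+-identityʳ n)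
  Σ<-extend n {g} z (suc e) = begin
    Σ< (n +ℕ suc e) g           ≡⟨ cong (λ k → Σ< k g) (ℕP.+-suc n e) ⟩
    Σ< (n +ℕ e) g + g (n +ℕ e)  ≡⟨ cong₂ _+_ (Σ<-extend n z e) (z _ (ℕP.m≤m+n n e)) ⟩
    Σ< n g + 0#                 ≡⟨ +-identityʳ _ ⟩
    Σ< n g                      ∎

  Σ<-+ : ∀ n (g h : ℕ → K) → Σ< n (λ t → g t + h t) ≡ Σ< n g + Σ< n h
  Σ<-+ zero g h = sym (+-identityʳ 0#)
  Σ<-+ (suc n) g h = trans (cong (_+ (g n + h n)) (Σ<-+ n g h)) (interchange _ _ _ _)

  Σ<-single : ∀ n s (g : ℕ → K) → s <ℕ n → (∀ t → t ≢ s → g t ≡ 0#) → Σ< n g ≡ g s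
  Σ<-single (suc n) s g (s≤s s≤n) z with ℕP.m≤n⇒m<n∨m≡n s≤n
  ... | inj₁ s<n = trans (cong₂ _+_ (Σ<-single n s g s<n z) (z n (λ e → ℕP.<-irrefl (sym e) s<n)))
                         (+-identityʳ _)
  ... | inj₂ refl = trans (cong₂ _+_ (Σ<-zero n (λ t t<n → z t (λ e → ℕP.<-irrefl e t<n))) refl)
                          (+-identityˡ _)

  timesX : (ℕ → K) → ℕ → K
  timesX g zero = 0#
  timesX g (suc i) = g i

  timesX-cong : ∀ {g h : ℕ → K} → (∀ i → g i ≡ h i) → ∀ i → timesX g i ≡ timesX h i
  timesX-cong e zero = refl
  timesX-cong e (suc i) = e i

  timesXᵏ : ℕ → (ℕ → K) → ℕ → K
  timesXᵏ j g = D.iter 𝔽 j timesX g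

  timesXᵏ-≥ : ∀ j g i → j ≤ℕ i → timesXᵏ j g i ≡ g (i ∸ j)
  timesXᵏ-≥ zero g i _ = refl
  timesXᵏ-≥ (suc j) g (suc i) (s≤s p) = timesXᵏ-≥ j g i p

  timesXᵏ-< : ∀ j g i → i <ℕ j → timesXᵏ j g i ≡ 0#
  timesXᵏ-< (suc j) g zero _ = refl
  timesXᵏ-< (suc j) g (suc i) (s≤s p) = timesXᵏ-< j g i p

  monomial-mulCoeff : ∀ k (u : ℕ → K) i →
    Σ< (suc i) (λ t → D.coeff 𝔽 (monomial k) t * u (i ∸ t)) ≡ timesXᵏ k u i
  monomial-mulCoeff k u i with k ℕ.≤? i
  ... | yes k≤i = begin
        Σ< (suc i) g
          ≡⟨ Σ<-single (suc i) k g (s≤s k≤i)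
               (λ t ne → trans (cong (_* u (i ∸ t)) (monomial-off k t ne)) (zeroˡ _)) ⟩
        g k
          ≡⟨ trans (cong (_* u (i ∸ k)) (leading-coeff (0ᵛ {k}) 1#)) (*-identityˡ _) ⟩
        u (i ∸ k)
          ≡⟨ sym (timesXᵏ-≥ k u i k≤i) ⟩
        timesXᵏ k u i ∎
        where g = λ t → D.coeff 𝔽 (monomial k) t * u (i ∸ t)
  ... | no k≰i = trans (Σ<-zero (suc i) vanish) (sym (timesXᵏ-< k u i (ℕP.≰⇒> k≰i)))
    where
      vanish : ∀ t → t <ℕ suc i → D.coeff 𝔽 (monomial k) t * u (i ∸ t) ≡ 0#
      vanish t t<si = trans (cong (_* u (i ∸ t))
        (monomial-off k t (λ e → k≰i (subst (ℕ._≤ i) e (ℕP.≤-pred t<si))))) (zeroˡ _)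

  coeff-cons0 : ∀ l j → D.coeff 𝔽 (0# ∷ l) j ≡ timesX (D.coeff 𝔽 l) j
  coeff-cons0 l zero = refl
  coeff-cons0 l (suc j) = refl

  shiftIn-toList : ∀ {k} b (x : Vec K k) →
    toList (proj₁ (D.shiftIn 𝔽 b x)) ++ [ proj₂ (D.shiftIn 𝔽 b x) ] ≡ b ∷ toList x
  shiftIn-toList b [] = refl
  shiftIn-toList b (a ∷ x) = cong (b ∷_) (shiftIn-toList a x)

  -- Reducing a polynomial s + t X^k of degree ≤ k modulo the monic f = X^k + Σ c_i X^i
  -- means subtracting t · f.
  entry-reduce : ∀ {k} (s c : Vec K k) t j →
    entry (zipWith (λ y ci → y + - (t * ci)) s c) j
      ≡ D.coeff 𝔽 (toList s ++ [ t ]) j + - (t * D.coeff 𝔽 (D.monicPoly 𝔽 c) j)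
  entry-reduce [] [] t zero = sym (trans (cong (λ z → t + - z) (*-identityʳ t)) (-‿inverseʳ t))
  entry-reduce [] [] t (suc j) =
    sym (trans (cong (λ z → 0# + - z) (zeroʳ t)) (trans (+-identityˡ _) -0#≈0#))
  entry-reduce (a ∷ s) (ci ∷ c) t zero = refl
  entry-reduce (a ∷ s) (ci ∷ c) t (suc j) = entry-reduce s c t j

  module MulByα {d : ℕ} (c : Vec K d) where
    L : Vec K d → Vec K d
    L = D.mulα 𝔽 c

    iterL : ℕ → Vec K d → Vec K d
    iterL j = D.iter 𝔽 j L

    fᵢ : ℕ → K
    fᵢ = D.coeff 𝔽 (D.monicPoly 𝔽 c)

    -- α·x is X·x reduced modulo f: its entries are (Xx)_j − (Xx)_d · f_j.
    entry-L : ∀ x j → entry (L x) j ≡ timesX (entry x) j + - (timesX (entry x) d * fᵢ j)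
    entry-L x j = begin
      entry (L x) j
        ≡⟨ entry-reduce s c t j ⟩
      D.coeff 𝔽 (toList s ++ [ t ]) j + - (t * fᵢ j)
        ≡⟨ cong₂ (λ u v → u + - (v * fᵢ j)) (coeff-Xx j) (trans (sym (leading-coeff s t)) (coeff-Xx d)) ⟩
      timesX (entry x) j + - (timesX (entry x) d * fᵢ j) ∎
      where
        s = proj₁ (D.shiftIn 𝔽 0# x)
        t = proj₂ (D.shiftIn 𝔽 0# x)
        coeff-Xx : ∀ i → D.coeff 𝔽 (toList s ++ [ t ]) i ≡ timesX (entry x) i
        coeff-Xx i = trans (cong (λ l → D.coeff 𝔽 l i) (shiftIn-toList 0# x)) (coeff-cons0 (toList x) i)

    timesX-⊕ : ∀ (x y : Vec K d) i → timesX (entry (x ⊕ y)) i ≡ timesX (entry x) i + timesX (entry y) i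
    timesX-⊕ x y zero = sym (+-identityʳ 0#)
    timesX-⊕ x y (suc i) = entry-⊕ x y i

    timesX-· : ∀ a (x : Vec K d) i → timesX (entry (a · x)) i ≡ a * timesX (entry x) i
    timesX-· a x zero = sym (zeroʳ a)
    timesX-· a x (suc i) = entry-· a x i

    L-⊕ : ∀ x y → L (x ⊕ y) ≡ L x ⊕ L y
    L-⊕ x y = entry-ext λ j → begin
      entry (L (x ⊕ y)) j
        ≡⟨ entry-L (x ⊕ y) j ⟩
      X (x ⊕ y) j + - (X (x ⊕ y) d * fᵢ j)
        ≡⟨ cong₂ (λ u v → u + - (v * fᵢ j)) (timesX-⊕ x y j) (timesX-⊕ x y d) ⟩
      (X x j + X y j) + - ((X x d + X y d) * fᵢ j)
        ≡⟨ cong (λ z → (X x j + X y j) + - z) (distribʳ (fᵢ j) _ _) ⟩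
      (X x j + X y j) + - (X x d * fᵢ j + X y d * fᵢ j)
        ≡⟨ cong ((X x j + X y j) +_) (sym (-‿+-comm _ _)) ⟩
      (X x j + X y j) + (- (X x d * fᵢ j) + - (X y d * fᵢ j))
        ≡⟨ interchange _ _ _ _ ⟩
      (X x j + - (X x d * fᵢ j)) + (X y j + - (X y d * fᵢ j))
        ≡⟨ sym (cong₂ _+_ (entry-L x j) (entry-L y j)) ⟩
      entry (L x) j + entry (L y) j
        ≡⟨ sym (entry-⊕ (L x) (L y) j) ⟩
      entry (L x ⊕ L y) j ∎
      where
        X : Vec K d → ℕ → K
        X z = timesX (entry z)

    L-· : ∀ a x → L (a · x) ≡ a · L x
    L-· a x = entry-ext λ j → begin
      entry (L (a · x)) j
        ≡⟨ entry-L (a · x) j ⟩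
      X (a · x) j + - (X (a · x) d * fᵢ j)
        ≡⟨ cong₂ (λ u v → u + - (v * fᵢ j)) (timesX-· a x j) (timesX-· a x d) ⟩
      a * X x j + - ((a * X x d) * fᵢ j)
        ≡⟨ cong (λ z → a * X x j + - z) (*-assoc a _ _) ⟩
      a * X x j + - (a * (X x d * fᵢ j))
        ≡⟨ cong (a * X x j +_) (-‿distribʳ-* a _) ⟩
      a * X x j + a * - (X x d * fᵢ j)
        ≡⟨ sym (distribˡ a _ _) ⟩
      a * (X x j + - (X x d * fᵢ j))
        ≡⟨ cong (a *_) (sym (entry-L x j)) ⟩
      a * entry (L x) j
        ≡⟨ sym (entry-· a (L x) j) ⟩
      entry (a · L x) j ∎
      where
        X : Vec K d → ℕ → K
        X z = timesX (entry z)

    L-0 : L 0ᵛ ≡ 0ᵛ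
    L-0 = linear-0 L L-·

    iterL-no-overflow : ∀ (U : Vec K d) b → DegreeBelow U b → ∀ j → j +ℕ b ≤ℕ d →
                        ∀ i → entry (iterL j U) i ≡ timesXᵏ j (entry U) i
    iterL-no-overflow U b degU zero le i = refl
    iterL-no-overflow U b degU (suc j) le i = begin
      entry (L y) i
        ≡⟨ entry-L y i ⟩
      timesX (entry y) i + - (timesX (entry y) d * fᵢ i)
        ≡⟨ cong₂ (λ u v → u + - (v * fᵢ i)) (timesX-cong IH i) (timesX-cong IH d) ⟩
      timesXᵏ (suc j) (entry U) i + - (timesXᵏ (suc j) (entry U) d * fᵢ i)
        ≡⟨ cong (λ v → timesXᵏ (suc j) (entry U) i + - (v * fᵢ i)) top-zero ⟩
      timesXᵏ (suc j) (entry U) i + - (0# * fᵢ i)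
        ≡⟨ minus-0* _ _ ⟩
      timesXᵏ (suc j) (entry U) i ∎
      where
        y = iterL j U
        IH = iterL-no-overflow U b degU j (ℕP.≤-trans (ℕP.n≤1+n _) le)
        -- the coefficient that would overflow into position d is a coefficient of U of index ≥ b
        top-zero : timesXᵏ (suc j) (entry U) d ≡ 0#
        top-zero = trans (timesXᵏ-≥ (suc j) (entry U) d (ℕP.m+n≤o⇒m≤o (suc j) le))
          (degU _ (subst (_≤ℕ d ∸ suc j) (ℕP.m+n∸m≡n (suc j) b) (ℕP.∸-monoˡ-≤ (suc j) le)))

    -- The multiplication of E = K[X]/(f): a vector h ∈ K^k, read as a polynomial of
    -- degree < k, acts on y ∈ E by h ⋆ y = Σ_t h_t α^t y = h(α)·y.
    _⋆_ : ∀ {k} → Vec K k → Vec K d → Vec K d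
    [] ⋆ y = 0ᵛ
    (a ∷ h) ⋆ y = a · y ⊕ h ⋆ L y
    infixr 8 _⋆_

    record CommutesWithα (T : Vec K d → Vec K d) : Set where
      field
        hom-⊕ : ∀ x y → T (x ⊕ y) ≡ T x ⊕ T y
        hom-· : ∀ a x → T (a · x) ≡ a · T x
        hom-L : ∀ x → T (L x) ≡ L (T x)

    ⋆-⊕ʳ : ∀ {k} (h : Vec K k) y z → h ⋆ (y ⊕ z) ≡ h ⋆ y ⊕ h ⋆ z
    ⋆-⊕ʳ [] y z = sym (⊕-identityˡ 0ᵛ)
    ⋆-⊕ʳ (a ∷ h) y z = begin
      a · (y ⊕ z) ⊕ h ⋆ L (y ⊕ z)
        ≡⟨ cong₂ _⊕_ (·-distribˡ a y z) (trans (cong (h ⋆_) (L-⊕ y z)) (⋆-⊕ʳ h (L y) (L z))) ⟩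
      (a · y ⊕ a · z) ⊕ (h ⋆ L y ⊕ h ⋆ L z)
        ≡⟨ ⊕-interchange _ _ _ _ ⟩
      (a · y ⊕ h ⋆ L y) ⊕ (a · z ⊕ h ⋆ L z) ∎

    ⋆-·ʳ : ∀ {k} (h : Vec K k) a y → h ⋆ (a · y) ≡ a · h ⋆ y
    ⋆-·ʳ [] a y = sym (·-zeroʳ a)
    ⋆-·ʳ (b ∷ h) a y = begin
      b · (a · y) ⊕ h ⋆ L (a · y)
        ≡⟨ cong₂ _⊕_ ·-swap (trans (cong (h ⋆_) (L-· a y)) (⋆-·ʳ h a (L y))) ⟩
      a · (b · y) ⊕ a · h ⋆ L y
        ≡⟨ sym (·-distribˡ a _ _) ⟩
      a · (b · y ⊕ h ⋆ L y) ∎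
      where
        ·-swap : b · (a · y) ≡ a · (b · y)
        ·-swap = trans (·-assoc b a y) (trans (cong (_· y) (*-comm b a)) (sym (·-assoc a b y)))

    ⋆-L : ∀ {k} (h : Vec K k) y → h ⋆ L y ≡ L (h ⋆ y)
    ⋆-L [] y = sym L-0
    ⋆-L (a ∷ h) y = begin
      a · L y ⊕ h ⋆ L (L y)     ≡⟨ cong₂ _⊕_ (sym (L-· a y)) (⋆-L h (L y)) ⟩
      L (a · y) ⊕ L (h ⋆ L y)   ≡⟨ sym (L-⊕ (a · y) (h ⋆ L y)) ⟩
      L (a · y ⊕ h ⋆ L y)       ∎

    ⋆-commutesWithα : ∀ {k} (h : Vec K k) → CommutesWithα (h ⋆_)
    ⋆-commutesWithα h = record { hom-⊕ = ⋆-⊕ʳ h ; hom-· = ⋆-·ʳ h ; hom-L = ⋆-L h }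

    ⋆-⊕ˡ : ∀ {k} (x x′ : Vec K k) y → (x ⊕ x′) ⋆ y ≡ x ⋆ y ⊕ x′ ⋆ y
    ⋆-⊕ˡ [] [] y = sym (⊕-identityˡ 0ᵛ)
    ⋆-⊕ˡ (a ∷ x) (b ∷ x′) y = begin
      (a + b) · y ⊕ (x ⊕ x′) ⋆ L y
        ≡⟨ cong₂ _⊕_ (·-distribʳ a b y) (⋆-⊕ˡ x x′ (L y)) ⟩
      (a · y ⊕ b · y) ⊕ (x ⋆ L y ⊕ x′ ⋆ L y)
        ≡⟨ ⊕-interchange _ _ _ _ ⟩
      (a · y ⊕ x ⋆ L y) ⊕ (b · y ⊕ x′ ⋆ L y) ∎

    ⋆-·ˡ : ∀ {k} a (x : Vec K k) y → (a · x) ⋆ y ≡ a · x ⋆ y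
    ⋆-·ˡ a [] y = sym (·-zeroʳ a)
    ⋆-·ˡ a (b ∷ x) y = begin
      (a * b) · y ⊕ (a · x) ⋆ L y  ≡⟨ cong₂ _⊕_ (sym (·-assoc a b y)) (⋆-·ˡ a x (L y)) ⟩
      a · (b · y) ⊕ a · x ⋆ L y    ≡⟨ sym (·-distribˡ a _ _) ⟩
      a · (b · y ⊕ x ⋆ L y)        ∎

    ⋆-zeroˡ : ∀ {k} y → 0ᵛ {k} ⋆ y ≡ 0ᵛ
    ⋆-zeroˡ {zero} y = refl
    ⋆-zeroˡ {suc k} y = begin
      0# · y ⊕ 0ᵛ {k} ⋆ L y  ≡⟨ cong₂ _⊕_ (·-zeroˡ y) (⋆-zeroˡ {k} (L y)) ⟩
      0ᵛ ⊕ 0ᵛ                ≡⟨ ⊕-identityˡ 0ᵛ ⟩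
      0ᵛ                     ∎

    commutesWithα-⋆ : ∀ {T} → CommutesWithα T → ∀ {k} (h : Vec K k) y → T (h ⋆ y) ≡ h ⋆ T y
    commutesWithα-⋆ {T} comm [] y = linear-0 T (CommutesWithα.hom-· comm)
    commutesWithα-⋆ {T} comm (a ∷ h) y = begin
      T (a · y ⊕ h ⋆ L y)        ≡⟨ hom-⊕ (a · y) (h ⋆ L y) ⟩
      T (a · y) ⊕ T (h ⋆ L y)    ≡⟨ cong₂ _⊕_ (hom-· a y) (commutesWithα-⋆ comm h (L y)) ⟩
      a · T y ⊕ h ⋆ T (L y)      ≡⟨ cong (λ z → a · T y ⊕ h ⋆ z) (hom-L y) ⟩
      a · T y ⊕ h ⋆ L (T y)      ∎
      where open CommutesWithα comm

    entry-⋆ : ∀ {k} (h : Vec K k) y i → entry (h ⋆ y) i ≡ Σ< k (λ t → entry h t * entry (iterL t y) i)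
    entry-⋆ [] y i = entry-0ᵛ {d} i
    entry-⋆ {suc k} (a ∷ h) y i = begin
      entry (a · y ⊕ h ⋆ L y) i
        ≡⟨ entry-⊕ (a · y) (h ⋆ L y) i ⟩
      entry (a · y) i + entry (h ⋆ L y) i
        ≡⟨ cong₂ _+_ (entry-· a y i) (entry-⋆ h (L y) i) ⟩
      a * entry y i + Σ< k (λ t → entry h t * entry (iterL t (L y)) i)
        ≡⟨ cong (a * entry y i +_) (Σ<-cong k (λ t _ → cong (λ v → entry h t * entry v i) (iter-L t y))) ⟩
      a * entry y i + Σ< k (λ t → entry h t * entry (iterL (suc t) y) i)
        ≡⟨ sym (Σ<-front k (λ t → entry (a ∷ h) t * entry (iterL t y) i)) ⟩
      Σ< (suc k) (λ t → entry (a ∷ h) t * entry (iterL t y) i) ∎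
      where
        iter-L : ∀ t y → iterL t (L y) ≡ L (iterL t y)
        iter-L zero y = refl
        iter-L (suc t) y = cong L (iter-L t y)

    ⋆-polynomial : ∀ {k} (h : Vec K k) (U : Vec K d) b → DegreeBelow U b → k +ℕ b ≤ℕ suc d →
                   ∀ i → entry (h ⋆ U) i ≡ D.mulCoeff 𝔽 (toList h) (toList U) i
    ⋆-polynomial {k} h U b degU le i = begin
      entry (h ⋆ U) i
        ≡⟨ entry-⋆ h U i ⟩
      Σ< k (λ t → entry h t * entry (iterL t U) i)
        ≡⟨ Σ<-cong k (λ t t<k → cong (entry h t *_) (iterL-no-overflow U b degU t (fits t t<k) i)) ⟩
      Σ< k P
        ≡⟨ sym (Σ<-extend k beyond-h (suc i)) ⟩
      Σ< (k +ℕ suc i) P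
        ≡⟨ cong (λ n → Σ< n P) (ℕP.+-comm k (suc i)) ⟩
      Σ< (suc i +ℕ k) P
        ≡⟨ Σ<-extend (suc i) beyond-i k ⟩
      Σ< (suc i) P
        ≡⟨ Σ<-cong (suc i) (λ t t<si → cong (entry h t *_) (timesXᵏ-≥ t (entry U) i (ℕP.≤-pred t<si))) ⟩
      D.mulCoeff 𝔽 (toList h) (toList U) i ∎
      where
        P : ℕ → K
        P t = entry h t * timesXᵏ t (entry U) i
        fits : ∀ t → t <ℕ k → t +ℕ b ≤ℕ d
        fits t t<k = ℕP.≤-pred (ℕP.≤-trans (ℕP.+-monoˡ-≤ b t<k) le)
        beyond-h : ∀ t → k ≤ℕ t → P t ≡ 0#
        beyond-h t p = trans (cong (_* timesXᵏ t (entry U) i) (entry-beyond h t p)) (zeroˡ _)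
        beyond-i : ∀ t → suc i ≤ℕ t → P t ≡ 0#
        beyond-i t p = trans (cong (entry h t *_) (timesXᵏ-< t (entry U) i p)) (zeroʳ _)

    ⋆-zeroʳ : ∀ {k} (h : Vec K k) → h ⋆ 0ᵛ ≡ 0ᵛ
    ⋆-zeroʳ h = linear-0 (h ⋆_) (⋆-·ʳ h)

    division-step : ∀ U e → entry U e ≡ 1# → DegreeBelow U (suc e) →
                    ∀ r′ → DegreeBelow r′ (suc e) →
                    Σ (Vec K d) λ r → DegreeBelow r e × r′ ≡ entry r′ e · U ⊕ r
    division-step U e u1 degU r′ degr′ = r , degr , eq
      where
        a = entry r′ e
        r = r′ ⊕ (- a) · U
        entry-r : ∀ i → entry r i ≡ entry r′ i + (- a) * entry U i
        entry-r i = trans (entry-⊕ r′ ((- a) · U) i) (cong (entry r′ i +_) (entry-· (- a) U i))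
        degr : DegreeBelow r e
        degr i e≤i with ℕP.m≤n⇒m<n∨m≡n e≤i
        ... | inj₁ e<i = trans (entry-r i)
                (trans (cong₂ (λ u v → u + (- a) * v) (degr′ i e<i) (degU i e<i))
                       (trans (cong (0# +_) (zeroʳ _)) (+-identityʳ 0#)))
        ... | inj₂ refl = trans (entry-r e)
                (trans (cong (λ v → a + (- a) * v) u1) (trans (cong (a +_) (*-identityʳ _)) (-‿inverseʳ a)))
        eq : r′ ≡ a · U ⊕ r
        eq = sym (begin
          a · U ⊕ (r′ ⊕ (- a) · U)   ≡⟨ sym (⊕-assoc (a · U) r′ _) ⟩
          (a · U ⊕ r′) ⊕ (- a) · U   ≡⟨ cong (_⊕ (- a) · U) (⊕-comm (a · U) r′) ⟩
          (r′ ⊕ a · U) ⊕ (- a) · U   ≡⟨ ⊕-assoc r′ (a · U) _ ⟩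
          r′ ⊕ (a · U ⊕ (- a) · U)   ≡⟨ cong (r′ ⊕_) (sym (·-distribʳ a (- a) U)) ⟩
          r′ ⊕ (a + - a) · U         ≡⟨ cong (λ t → r′ ⊕ t · U) (-‿inverseʳ a) ⟩
          r′ ⊕ 0# · U                ≡⟨ cong (r′ ⊕_) (·-zeroˡ U) ⟩
          r′ ⊕ 0ᵛ                    ≡⟨ ⊕-identityʳ r′ ⟩
          r′                         ∎)

    L-monic : ∀ U e → entry U e ≡ 1# → DegreeBelow U (suc e) → suc (suc e) ≤ℕ d →
              entry (L U) (suc e) ≡ 1# × DegreeBelow (L U) (suc (suc e))
    L-monic U e u1 degU room = trans (shift (suc e)) u1 , λ { (suc i) (s≤s p) → trans (shift (suc i)) (degU i p) }
      where
        shift : ∀ i → entry (L U) i ≡ timesX (entry U) i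
        shift = iterL-no-overflow U (suc e) degU 1 room

    divide : ∀ s U e → entry U e ≡ 1# → DegreeBelow U (suc e) → e +ℕ s ≤ℕ d →
             ∀ w → DegreeBelow w (e +ℕ s) →
             Σ (Vec K s) λ h → Σ (Vec K d) λ r → DegreeBelow r e × w ≡ h ⋆ U ⊕ r
    divide zero U e u1 degU le w degw =
      [] , w , (λ i p → degw i (subst (_≤ℕ i) (sym (ℕP.+-identityʳ e)) p)) , sym (⊕-identityˡ w)
    divide (suc zero) U e u1 degU le w degw
      with division-step U e u1 degU w (λ i p → degw i (subst (_≤ℕ i) (ℕP.+-comm 1 e) p))
    ... | r , degr , eq = (entry w e ∷ []) , r , degr , trans eq (cong (_⊕ r) (sym (⊕-identityʳ _)))
    divide (suc (suc s)) U e u1 degU le w degw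
      with divide (suc s) (L U) (suc e) (proj₁ LU-monic) (proj₂ LU-monic)
                  (subst (_≤ℕ d) (ℕP.+-suc e (suc s)) le) w
                  (λ i p → degw i (subst (_≤ℕ i) (sym (ℕP.+-suc e (suc s))) p))
      where
        room : suc (suc e) ≤ℕ d
        room = ℕP.≤-trans (s≤s (s≤s (ℕP.m≤n+m e s)))
                          (ℕP.≤-trans (ℕP.≤-reflexive (ℕP.+-comm (suc (suc s)) e)) le)
        LU-monic = L-monic U e u1 degU room
    ... | h′ , r′ , degr′ , eq′ with division-step U e u1 degU r′ degr′
    ... | r , degr , eq = (entry r′ e ∷ h′) , r , degr , (begin
          w                                   ≡⟨ eq′ ⟩
          h′ ⋆ L U ⊕ r′                       ≡⟨ cong (h′ ⋆ L U ⊕_) eq ⟩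
          h′ ⋆ L U ⊕ (entry r′ e · U ⊕ r)     ≡⟨ sym (⊕-assoc (h′ ⋆ L U) _ r) ⟩
          (h′ ⋆ L U ⊕ entry r′ e · U) ⊕ r     ≡⟨ cong (_⊕ r) (⊕-comm (h′ ⋆ L U) _) ⟩
          (entry r′ e · U ⊕ h′ ⋆ L U) ⊕ r     ∎)

    -- For monic U of degree b with b + s + 1 = d, α^(s+1) U overflows exactly once:
    -- it equals X^(s+1) U − f.
    iterL-overflow : ∀ s b (U : Vec K d) → b +ℕ suc s ≡ d → entry U b ≡ 1# → DegreeBelow U (suc b) →
                     ∀ i → entry (iterL (suc s) U) i ≡ timesXᵏ (suc s) (entry U) i + - fᵢ i
    iterL-overflow s b U hd u1 degU i = begin
      entry (L V) i
        ≡⟨ entry-L V i ⟩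
      timesX (entry V) i + - (timesX (entry V) d * fᵢ i)
        ≡⟨ cong₂ (λ u v → u + - (v * fᵢ i)) (timesX-cong shifted i) (trans (timesX-cong shifted d) top) ⟩
      timesXᵏ (suc s) (entry U) i + - (1# * fᵢ i)
        ≡⟨ cong (λ v → timesXᵏ (suc s) (entry U) i + - v) (*-identityˡ _) ⟩
      timesXᵏ (suc s) (entry U) i + - fᵢ i ∎
      where
        V = iterL s U
        shifted : ∀ i → entry V i ≡ timesXᵏ s (entry U) i
        shifted = iterL-no-overflow U (suc b) degU s
          (ℕP.≤-reflexive (trans (ℕP.+-suc s b) (trans (cong suc (ℕP.+-comm s b)) (trans (sym (ℕP.+-suc b s)) hd))))
        -- the coefficient pushed to position d is the leading coefficient of U
        top : timesXᵏ (suc s) (entry U) d ≡ 1#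
        top = begin
          timesXᵏ (suc s) (entry U) d ≡⟨ timesXᵏ-≥ (suc s) (entry U) d (subst (suc s ≤ℕ_) hd (ℕP.m≤n+m (suc s) b)) ⟩
          entry U (d ∸ suc s)         ≡⟨ cong (λ k → entry U (k ∸ suc s)) (sym hd) ⟩
          entry U (b +ℕ suc s ∸ suc s) ≡⟨ cong (entry U) (ℕP.m+n∸n≡m b (suc s)) ⟩
          entry U b                   ≡⟨ u1 ⟩
          1#                          ∎

    factorisation : ∀ s b (U : Vec K d) (h : Vec K (suc s)) → b +ℕ suc s ≡ d → entry U b ≡ 1# →
                    DegreeBelow U (suc b) → iterL (suc s) U ≡ h ⋆ U →
                    ∀ i → D.mulCoeff 𝔽 (D.monicPoly 𝔽 (⊖ h)) (toList U) i ≡ fᵢ i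
    factorisation s b U h hd u1 degU eqW i = begin
      Σ< (suc i) (λ t → D.coeff 𝔽 (D.monicPoly 𝔽 (⊖ h)) t * entry U (i ∸ t))
        ≡⟨ Σ<-cong (suc i) (λ t _ → trans (cong (_* entry U (i ∸ t)) (monicPoly-split (⊖ h) t)) (distribʳ _ _ _)) ⟩
      Σ< (suc i) (λ t → entry (⊖ h) t * entry U (i ∸ t) + Xˢ⁺¹ t * entry U (i ∸ t))
        ≡⟨ Σ<-+ (suc i) _ _ ⟩
      D.mulCoeff 𝔽 (toList (⊖ h)) (toList U) i + Σ< (suc i) (λ t → Xˢ⁺¹ t * entry U (i ∸ t))
        ≡⟨ cong₂ _+_ (sym (⋆-polynomial (⊖ h) U (suc b) degU fits i)) (monomial-mulCoeff (suc s) (entry U) i) ⟩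
      entry ((⊖ h) ⋆ U) i + S
        ≡⟨ cong (_+ S) (trans (cong (λ v → entry v i) (⋆-·ˡ (- 1#) h U)) (entry-· (- 1#) (h ⋆ U) i)) ⟩
      (- 1#) * entry (h ⋆ U) i + S
        ≡⟨ cong (λ v → (- 1#) * v + S)
             (trans (cong (λ v → entry v i) (sym eqW)) (iterL-overflow s b U hd u1 degU i)) ⟩
      (- 1#) * (S + - fᵢ i) + S
        ≡⟨ negate-and-add S (fᵢ i) ⟩
      fᵢ i ∎
      where
        S = timesXᵏ (suc s) (entry U) i
        Xˢ⁺¹ = D.coeff 𝔽 (monomial (suc s))
        fits : suc s +ℕ suc b ≤ℕ suc d
        fits = s≤s (ℕP.≤-reflexive (trans (ℕP.+-comm s (suc b)) (trans (sym (ℕP.+-suc b s)) hd)))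

  module Ring {d′ : ℕ} (c : Vec K (suc d′)) where
    open MulByα c public

    d : ℕ
    d = suc d′

    one : Vec K d
    one = 1# ∷ 0ᵛ

    one-degree : DegreeBelow one 1
    one-degree (suc i) _ = entry-0ᵛ {d′} i

    ⋆-identityˡ : ∀ y → one ⋆ y ≡ y
    ⋆-identityˡ y = begin
      1# · y ⊕ 0ᵛ {d′} ⋆ L y ≡⟨ cong₂ _⊕_ (·-identity y) (⋆-zeroˡ {d′} (L y)) ⟩
      y ⊕ 0ᵛ                 ≡⟨ ⊕-identityʳ y ⟩
      y                      ∎

    ⋆-identityʳ : ∀ (x : Vec K d) → x ⋆ one ≡ x
    ⋆-identityʳ x = entry-ext λ i → begin
      entry (x ⋆ one) i
        ≡⟨ ⋆-polynomial x one 1 one-degree (ℕP.≤-reflexive (ℕP.+-comm d 1)) i ⟩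
      Σ< i (λ t → entry x t * entry one (i ∸ t)) + entry x i * entry one (i ∸ i)
        ≡⟨ cong₂ _+_ (Σ<-zero i (λ t t<i → trans (cong (entry x t *_) (one-off t i t<i)) (zeroʳ _)))
                     (cong (λ k → entry x i * entry one k) (ℕP.n∸n≡0 i)) ⟩
      0# + entry x i * 1#
        ≡⟨ trans (+-identityˡ _) (*-identityʳ _) ⟩
      entry x i ∎
      where
        one-off : ∀ t i → t <ℕ i → entry one (i ∸ t) ≡ 0#
        one-off zero (suc i) _ = entry-0ᵛ {d′} i
        one-off (suc t) (suc i) (s≤s p) = one-off t i p

    -- An α-commuting linear map is multiplication by the image of 1: T x = T (x ⋆ 1) = x ⋆ T 1.
    commutesWithα⇒⋆ : ∀ {T} → CommutesWithα T → ∀ x → T x ≡ x ⋆ T one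
    commutesWithα⇒⋆ {T} comm x = trans (cong T (sym (⋆-identityʳ x))) (commutesWithα-⋆ comm x one)

    ⋆-comm : ∀ (x y : Vec K d) → x ⋆ y ≡ y ⋆ x
    ⋆-comm x y = trans (commutesWithα⇒⋆ (⋆-commutesWithα x) y) (cong (y ⋆_) (⋆-identityʳ x))

    ⋆-assoc : ∀ (x y z : Vec K d) → (x ⋆ y) ⋆ z ≡ x ⋆ (y ⋆ z)
    ⋆-assoc x y z = trans (commutesWithα⇒⋆ T-comm x) (cong (λ w → x ⋆ (w ⋆ z)) (⋆-identityˡ y))
      where
        T : Vec K d → Vec K d
        T w = (w ⋆ y) ⋆ z
        L⋆ : ∀ w y → L w ⋆ y ≡ L (w ⋆ y)
        L⋆ w y = trans (⋆-comm (L w) y) (trans (⋆-L y w) (cong L (⋆-comm y w)))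
        T-comm : CommutesWithα T
        T-comm = record
          { hom-⊕ = λ w w′ → trans (cong (_⋆ z) (⋆-⊕ˡ w w′ y)) (⋆-⊕ˡ (w ⋆ y) (w′ ⋆ y) z)
          ; hom-· = λ a w → trans (cong (_⋆ z) (⋆-·ˡ a w y)) (⋆-·ˡ a (w ⋆ y) z)
          ; hom-L = λ w → trans (cong (_⋆ z) (L⋆ w y)) (L⋆ (w ⋆ y) z)
          }

    -- For fixed γ ≠ 0, induction on b
    -- shows that every z with γ ⋆ z = 0 and deg z < b vanishes.  A counterexample z of
    -- least degree normalises to a monic U; U = 1 would give γ = 0, and otherwise
    -- dividing α^(d - deg U) U by U leaves an annihilated remainder of smaller degree,
    -- which therefore vanishes, so U divides f non-trivially.
    module NoZeroDivisors (_≟K_ : DecidableEquality K) (irr : D.Irreducible 𝔽 (D.monicPoly 𝔽 c))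
                          (γ : Vec K d) (γ≢0 : γ ≢ 0ᵛ) where
      Annihilated : Vec K d → Set
      Annihilated z = γ ⋆ z ≡ 0ᵛ

      AnnihilatedBelowVanish : ℕ → Set
      AnnihilatedBelowVanish b = ∀ z → Annihilated z → DegreeBelow z b → z ≡ 0ᵛ

      annihilated-⋆ : ∀ {k} (h : Vec K k) U → Annihilated U → Annihilated (h ⋆ U)
      annihilated-⋆ h U annU = begin
        γ ⋆ h ⋆ U   ≡⟨ commutesWithα-⋆ (⋆-commutesWithα γ) h U ⟩
        h ⋆ γ ⋆ U   ≡⟨ cong (h ⋆_) annU ⟩
        h ⋆ 0ᵛ      ≡⟨ ⋆-zeroʳ h ⟩
        0ᵛ          ∎

      annihilated-iterL : ∀ j z → Annihilated z → Annihilated (iterL j z)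
      annihilated-iterL zero z annz = annz
      annihilated-iterL (suc j) z annz =
        trans (⋆-L γ (iterL j z)) (trans (cong L (annihilated-iterL j z annz)) L-0)

      annihilated-cancel : ∀ x r → Annihilated (x ⊕ r) → Annihilated x → Annihilated r
      annihilated-cancel x r annxr annx = begin
        γ ⋆ r             ≡⟨ sym (⊕-identityˡ (γ ⋆ r)) ⟩
        0ᵛ ⊕ γ ⋆ r        ≡⟨ cong (_⊕ γ ⋆ r) (sym annx) ⟩
        γ ⋆ x ⊕ γ ⋆ r     ≡⟨ sym (⋆-⊕ʳ γ x r) ⟩
        γ ⋆ (x ⊕ r)       ≡⟨ annxr ⟩
        0ᵛ                ∎

      normalise : ∀ b z → Annihilated z → DegreeBelow z (suc b) → entry z b ≢ 0# →
                  Σ (Vec K d) λ U → entry U b ≡ 1# × DegreeBelow U (suc b) × Annihilated U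
      normalise b z annz degz zb≢0 with inverse (entry z b) zb≢0
      ... | y , zb*y≡1 =
            y · z
          , trans (entry-· y z b) (trans (*-comm y _) zb*y≡1)
          , (λ i p → trans (entry-· y z i) (trans (cong (y *_) (degz i p)) (zeroʳ y)))
          , trans (⋆-·ʳ γ y z) (trans (cong (y ·_) annz) (·-zeroʳ y))

      monic-annihilator-splits-f : ∀ b s → suc (suc b) +ℕ s ≡ d → AnnihilatedBelowVanish (suc b) →
                                   ∀ U → entry U (suc b) ≡ 1# → DegreeBelow U (suc (suc b)) → Annihilated U → ⊥
      monic-annihilator-splits-f b s hd minimal U u1 degU annU =
        [ leading-1 G (leading-coeff (⊖ h) 1#) , leading-1 (toList U) u1 ]′
          (proj₂ irr G (toList U) (factorisation s (suc b) U h hd′ u1 degU W≡h⋆U))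
        where
          hd′ : suc b +ℕ suc s ≡ d
          hd′ = trans (ℕP.+-suc (suc b) s) hd
          W = iterL (suc s) U
          division = divide (suc s) U (suc b) u1 degU (ℕP.≤-reflexive hd′) W
                       (λ i p → entry-beyond W i (subst (_≤ℕ i) hd′ p))
          h = proj₁ division
          r = proj₁ (proj₂ division)
          degr = proj₁ (proj₂ (proj₂ division))
          W≡h⋆U⊕r = proj₂ (proj₂ (proj₂ division))
          -- the remainder is annihilated and of smaller degree, hence zero
          r≡0 : r ≡ 0ᵛ
          r≡0 = minimal r (annihilated-cancel (h ⋆ U) r
                  (subst Annihilated W≡h⋆U⊕r (annihilated-iterL (suc s) U annU)) (annihilated-⋆ h U annU)) degr
          W≡h⋆U : W ≡ h ⋆ U
          W≡h⋆U = trans W≡h⋆U⊕r (trans (cong (h ⋆ U ⊕_) r≡0) (⊕-identityʳ (h ⋆ U)))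
          G = D.monicPoly 𝔽 (⊖ h)
          leading-1 : ∀ p {k} → D.coeff 𝔽 p (suc k) ≡ 1# → D.Constant 𝔽 p → ⊥
          leading-1 p p₁ const = 0≢1 (trans (sym (const _)) p₁)

      no-monic-annihilated : ∀ b → AnnihilatedBelowVanish b →
                             ∀ U → entry U b ≡ 1# → DegreeBelow U (suc b) → Annihilated U → ⊥
      no-monic-annihilated zero _ U u1 degU annU = γ≢0 (begin
        γ         ≡⟨ sym (⋆-identityʳ γ) ⟩
        γ ⋆ one   ≡⟨ cong (γ ⋆_) (sym U≡one) ⟩
        γ ⋆ U     ≡⟨ annU ⟩
        0ᵛ        ∎)
        where
          U≡one : U ≡ one
          U≡one = entry-ext λ { zero → u1 ; (suc i) → trans (degU (suc i) (s≤s z≤n)) (sym (entry-0ᵛ {d′} i)) }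
      no-monic-annihilated (suc b) minimal U u1 degU annU with d ℕ.≤? suc b
      ... | yes d≤b = 0≢1 (trans (sym (entry-beyond U (suc b) d≤b)) u1)
      ... | no d≰b =
        monic-annihilator-splits-f b (d ∸ suc (suc b)) (ℕP.m+[n∸m]≡n (ℕP.≰⇒> d≰b)) minimal U u1 degU annU

      annihilated-vanish : ∀ b → AnnihilatedBelowVanish b
      annihilated-vanish zero z _ degz = entry-ext λ i → trans (degz i z≤n) (sym (entry-0ᵛ {d} i))
      annihilated-vanish (suc b) z annz degz with entry z b ≟K 0#
      ... | yes zb≡0 = annihilated-vanish b z annz (degree-lower z b degz zb≡0)
      ... | no zb≢0 with normalise b z annz degz zb≢0
      ...   | U , u1 , degU , annU = ⊥-elim (no-monic-annihilated b (annihilated-vanish b) U u1 degU annU)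

      no-zero-divisors : ∀ z → γ ⋆ z ≡ 0ᵛ → z ≡ 0ᵛ
      no-zero-divisors z annz = annihilated-vanish d z annz (entry-beyond z)

  ΣV : ∀ {d} k → (Fin k → Vec K d) → Vec K d
  ΣV = D.sumE 𝔽

  ΣV-cong : ∀ {d} k {g h : Fin k → Vec K d} → (∀ i → g i ≡ h i) → ΣV k g ≡ ΣV k h
  ΣV-cong zero e = refl
  ΣV-cong (suc k) e = cong₂ _⊕_ (e Fin.zero) (ΣV-cong k (e ∘ Fin.suc))

  ΣV-⊕ : ∀ {d} k (g h : Fin k → Vec K d) → ΣV k (λ i → g i ⊕ h i) ≡ ΣV k g ⊕ ΣV k h
  ΣV-⊕ zero g h = sym (⊕-identityˡ 0ᵛ)
  ΣV-⊕ (suc k) g h = trans (cong (g Fin.zero ⊕ h Fin.zero ⊕_) (ΣV-⊕ k (g ∘ Fin.suc) (h ∘ Fin.suc)))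
                           (⊕-interchange (g Fin.zero) (h Fin.zero) _ _)

  ΣV-linear : ∀ {d} (T : Vec K d → Vec K d) → (∀ x y → T (x ⊕ y) ≡ T x ⊕ T y) → T 0ᵛ ≡ 0ᵛ →
              ∀ k (g : Fin k → Vec K d) → T (ΣV k g) ≡ ΣV k (T ∘ g)
  ΣV-linear T T-⊕ T-0 zero g = T-0
  ΣV-linear T T-⊕ T-0 (suc k) g =
    trans (T-⊕ (g Fin.zero) _) (cong (T (g Fin.zero) ⊕_) (ΣV-linear T T-⊕ T-0 k (g ∘ Fin.suc)))

  ΣV-zero : ∀ {d} k (g : Fin k → Vec K d) → (∀ i → g i ≡ 0ᵛ) → ΣV k g ≡ 0ᵛ
  ΣV-zero zero g z = refl
  ΣV-zero (suc k) g z = trans (cong₂ _⊕_ (z Fin.zero) (ΣV-zero k (g ∘ Fin.suc) (z ∘ Fin.suc))) (⊕-identityˡ 0ᵛ)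

  ΣV-single : ∀ {d} k (g : Fin k → Vec K d) i₀ → (∀ i → i ≢ i₀ → g i ≡ 0ᵛ) → ΣV k g ≡ g i₀
  ΣV-single (suc k) g Fin.zero z =
    trans (cong (g Fin.zero ⊕_) (ΣV-zero k (g ∘ Fin.suc) (λ i → z (Fin.suc i) (λ ())))) (⊕-identityʳ _)
  ΣV-single (suc k) g (Fin.suc i₀) z =
    trans (cong₂ _⊕_ (z Fin.zero (λ ()))
                     (ΣV-single k (g ∘ Fin.suc) i₀ (λ i ne → z (Fin.suc i) (ne ∘ FinP.suc-injective))))
          (⊕-identityˡ _)

  module Bases {d : ℕ} (m n : ℕ) where
    Idx : Set
    Idx = Fin n × Fin m

    lc : (Idx → K) → (Idx → Vec K d) → Vec K d
    lc = D.lincomb 𝔽 m n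

    lc-congᶜ : ∀ {a a′ : Idx → K} b → (∀ k → a k ≡ a′ k) → lc a b ≡ lc a′ b
    lc-congᶜ b e = ΣV-cong n (λ j → ΣV-cong m (λ i → cong (_· b (j , i)) (e (j , i))))

    lc-congᵛ : ∀ a {b b′ : Idx → Vec K d} → (∀ k → b k ≡ b′ k) → lc a b ≡ lc a b′
    lc-congᵛ a e = ΣV-cong n (λ j → ΣV-cong m (λ i → cong (a (j , i) ·_) (e (j , i))))

    lc-⊕ : ∀ (a a′ : Idx → K) b → lc (λ k → a k + a′ k) b ≡ lc a b ⊕ lc a′ b
    lc-⊕ a a′ b = trans (ΣV-cong n (λ j → trans (ΣV-cong m (λ i → ·-distribʳ (a (j , i)) (a′ (j , i)) (b (j , i))))
                                                 (ΣV-⊕ m _ _)))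
                        (ΣV-⊕ n _ _)

    lc-linear : ∀ (T : Vec K d → Vec K d) → (∀ x y → T (x ⊕ y) ≡ T x ⊕ T y) → (∀ a x → T (a · x) ≡ a · T x) →
                ∀ a b → T (lc a b) ≡ lc a (T ∘ b)
    lc-linear T T-⊕ T-· a b =
      trans (ΣV-linear T T-⊕ T-0 n _) (ΣV-cong n (λ j → trans (ΣV-linear T T-⊕ T-0 m _) (ΣV-cong m (λ i → T-· _ _))))
      where T-0 = linear-0 T T-·

    lc-· : ∀ x (a : Idx → K) b → lc (λ k → x * a k) b ≡ x · lc a b
    lc-· x a b =
      trans (ΣV-cong n (λ j → trans (ΣV-cong m (λ i → sym (·-assoc x (a (j , i)) (b (j , i)))))
                                    (sym (ΣV-linear (x ·_) (·-distribˡ x) (·-zeroʳ x) m _))))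
            (sym (ΣV-linear (x ·_) (·-distribˡ x) (·-zeroʳ x) n _))

    lc-0 : ∀ b → lc (λ _ → 0#) b ≡ 0ᵛ
    lc-0 b = ΣV-zero n _ (λ j → ΣV-zero m _ (λ i → ·-zeroˡ (b (j , i))))

    δ : Idx → Idx → K
    δ l k with ≡-dec FinP._≟_ FinP._≟_ l k
    ... | yes _ = 1#
    ... | no _ = 0#

    δ-same : ∀ l → δ l l ≡ 1#
    δ-same l with ≡-dec FinP._≟_ FinP._≟_ l l
    ... | yes _ = refl
    ... | no l≢l = ⊥-elim (l≢l refl)

    δ-other : ∀ l k → l ≢ k → δ l k ≡ 0#
    δ-other l k l≢k with ≡-dec FinP._≟_ FinP._≟_ l k
    ... | yes l≡k = ⊥-elim (l≢k l≡k)
    ... | no _ = refl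

    lc-δ : ∀ l b → lc (δ l) b ≡ b l
    lc-δ (j₀ , i₀) b =
      trans (ΣV-single n _ j₀ (λ j j≢j₀ → ΣV-zero m _ (λ i → vanish (j , i) (j≢j₀ ∘ cong proj₁ ∘ sym))))
      (trans (ΣV-single m _ i₀ (λ i i≢i₀ → vanish (j₀ , i) (i≢i₀ ∘ cong proj₂ ∘ sym)))
             (trans (cong (_· b (j₀ , i₀)) (δ-same (j₀ , i₀))) (·-identity _)))
      where
        vanish : ∀ k → (j₀ , i₀) ≢ k → δ (j₀ , i₀) k · b k ≡ 0ᵛ
        vanish k ne = trans (cong (_· b k) (δ-other (j₀ , i₀) k ne)) (·-zeroˡ _)

    module Coordinates {b : Idx → Vec K d} (β : IsBasis 𝔽 m n b) where
      open IsBasis β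

      coord-⊕ : ∀ x y k → coord (x ⊕ y) k ≡ coord x k + coord y k
      coord-⊕ x y k = sym (unique (x ⊕ y) (λ k → coord x k + coord y k)
                        (trans (lc-⊕ (coord x) (coord y) b) (cong₂ _⊕_ (spans x) (spans y))) k)

      coord-· : ∀ a x k → coord (a · x) k ≡ a * coord x k
      coord-· a x k = sym (unique (a · x) (λ k → a * coord x k) (trans (lc-· a (coord x) b) (cong (a ·_) (spans x))) k)

      coord-basis : ∀ l k → coord (b l) k ≡ δ l k
      coord-basis l k = sym (unique (b l) (δ l) (lc-δ l b) k)

      basis≢0 : ∀ l → b l ≢ 0ᵛ
      basis≢0 l bl≡0 = 0≢1 (begin
        0#            ≡⟨ unique 0ᵛ (λ _ → 0#) (lc-0 b) l ⟩
        coord 0ᵛ l    ≡⟨ cong (λ x → coord x l) (sym bl≡0) ⟩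
        coord (b l) l ≡⟨ coord-basis l l ⟩
        δ l l         ≡⟨ δ-same l ⟩
        1#            ∎)

module Finite where

  -- Pigeonhole: an injective endomap of Fin Q is surjective.  If y were missed,
  -- i ↦ punchOut (y ≢ g i) would inject Fin Q into Fin (Q - 1).
  Fin-injective⇒surjective : ∀ {Q} (g : Fin Q → Fin Q) → (∀ {i j} → g i ≡ g j → i ≡ j) →
                             ∀ y → ∃ λ i → g i ≡ y
  Fin-injective⇒surjective {suc Q} g g-inj y with FinP.any? (λ i → g i FinP.≟ y)
  ... | yes hit = hit
  ... | no miss = ⊥-elim (ℕP.<-irrefl refl (FinP.injective⇒≤ squeeze-injective))
    where
      y≢g : ∀ i → y ≢ g i
      y≢g i e = miss (i , sym e)
      squeeze-injective : ∀ {i j} → Fin.punchOut (y≢g i) ≡ Fin.punchOut (y≢g j) → i ≡ j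
      squeeze-injective {i} {j} e = g-inj (FinP.punchOut-injective (y≢g i) (y≢g j) e)

  allFinExcept : ∀ {Q} → Fin Q → List (Fin Q)
  allFinExcept {suc Q} z = L.map (Fin.punchIn z) (L.allFin Q)

  allFinExcept-length : ∀ {Q} (z : Fin Q) → L.length (allFinExcept z) ≡ Q ∸ 1
  allFinExcept-length {suc Q} z = trans (length-map (Fin.punchIn z) (L.allFin Q)) (length-tabulate (λ i → i))

  allFinExcept-unique : ∀ {Q} (z : Fin Q) → Unique (allFinExcept z)
  allFinExcept-unique {suc Q} z = UniqueP.map⁺ (λ {x} {y} → FinP.punchIn-injective z x y) (UniqueP.allFin⁺ Q)

  ∈-allFinExcept : ∀ {Q} (z i : Fin Q) → z ≢ i → i ∈ allFinExcept z
  ∈-allFinExcept {suc Q} z i z≢i =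
    subst (_∈ allFinExcept z) (FinP.punchIn-punchOut z≢i) (∈-map⁺ (Fin.punchIn z) (∈-allFin (Fin.punchOut z≢i)))

  allFinExcept-∌ : ∀ {Q} (z i : Fin Q) → i ∈ allFinExcept z → i ≢ z
  allFinExcept-∌ {suc Q} z i i∈ with ∈-map⁻ (Fin.punchIn z) i∈
  ... | j , _ , refl = FinP.punchInᵢ≢i z j

  Vec↔Fin^ : ∀ {B : Set} {q} → B ↔ Fin q → ∀ d → Vec B d ↔ Fin (q ℕ.^ d)
  Vec↔Fin^ {B} {q} B↔Fin d = mk↔ₛ′ encode decode (encode-decode {d}) decode-encode
    where
      open Inverse B↔Fin
      encode : ∀ {k} → Vec B k → Fin (q ℕ.^ k)
      encode [] = Fin.zero
      encode (a ∷ x) = Fin.combine (to a) (encode x)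
      decode : ∀ {k} → Fin (q ℕ.^ k) → Vec B k
      decode {zero} _ = []
      decode {suc k} i = from (proj₁ (Fin.remQuot {q} (q ℕ.^ k) i)) ∷ decode (proj₂ (Fin.remQuot {q} (q ℕ.^ k) i))
      encode-decode : ∀ {k} i → encode (decode {k} i) ≡ i
      encode-decode {zero} Fin.zero = refl
      encode-decode {suc k} i =
        trans (cong₂ Fin.combine (strictlyInverseˡ _) (encode-decode {k} _)) (FinP.combine-remQuot {q} (q ℕ.^ k) i)
      decode-encode : ∀ {k} (x : Vec B k) → decode (encode x) ≡ x
      decode-encode [] = refl
      decode-encode {suc k} (a ∷ x) =
        cong₂ _∷_ (trans (cong (λ p → from (proj₁ p)) split) (strictlyInverseʳ a))
                  (trans (cong (λ p → decode (proj₂ p)) split) (decode-encode x))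
        where
          split : Fin.remQuot {q} (q ℕ.^ k) (Fin.combine (to a) (encode x)) ≡ (to a , encode x)
          split = FinP.remQuot-combine (to a) (encode x)

  module _ {A : Set} {Q : ℕ} (A↔Fin : A ↔ Fin Q) where
    open Inverse A↔Fin

    ≟-finite : DecidableEquality A
    ≟-finite = via-injection (↔⇒↣ A↔Fin) FinP._≟_

    from-injective : ∀ {i j} → from i ≡ from j → i ≡ j
    from-injective {i} {j} e = trans (sym (strictlyInverseˡ i)) (trans (cong to e) (strictlyInverseˡ j))

    to-injective : ∀ {x y} → to x ≡ to y → x ≡ y
    to-injective {x} {y} e = trans (sym (strictlyInverseʳ x)) (trans (cong from e) (strictlyInverseʳ y))

    injective⇒surjective : (g : A → A) → (∀ {x y} → g x ≡ g y → x ≡ y) → ∀ y → ∃ λ x → g x ≡ y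
    injective⇒surjective g g-inj y
      with Fin-injective⇒surjective (to ∘ g ∘ from) (from-injective ∘ g-inj ∘ to-injective) (to y)
    ... | i , e = from i , to-injective e

    allExcept : A → List A
    allExcept z = L.map from (allFinExcept (to z))

    allExcept-unique : ∀ z → Unique (allExcept z)
    allExcept-unique z = UniqueP.map⁺ from-injective (allFinExcept-unique (to z))

    allExcept-length : ∀ z → L.length (allExcept z) ≡ Q ∸ 1
    allExcept-length z = trans (length-map from (allFinExcept (to z))) (allFinExcept-length (to z))

    ∈-allExcept : ∀ z x → x ≢ z → x ∈ allExcept z
    ∈-allExcept z x x≢z = subst (_∈ allExcept z) (strictlyInverseʳ x)
      (∈-map⁺ from (∈-allFinExcept (to z) (to x) (λ e → x≢z (to-injective (sym e)))))

    allExcept-∌ : ∀ z x → x ∈ allExcept z → x ≢ z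
    allExcept-∌ z x x∈ with ∈-map⁻ from x∈
    ... | i , i∈ , refl = λ e → allFinExcept-∌ (to z) i i∈ (trans (sym (strictlyInverseˡ i)) (cong to e))

module AdmissibleBases (𝔽 : Field) {q : ℕ} (K↔Fin : Field.Carrier 𝔽 ↔ Fin q) (m′ n′ : ℕ)
                       (c : Vec (Field.Carrier 𝔽) (suc m′ ℕ.* suc n′))
                       (irr : D.Irreducible 𝔽 (D.monicPoly 𝔽 c)) where
  open Field 𝔽 renaming (Carrier to K)
  open Extension 𝔽
  open Ring {n′ +ℕ m′ ℕ.* suc n′} c
  open ≡-Reasoning

  m n : ℕ
  m = suc m′
  n = suc n′

  open Bases {d} m n

  E : Set
  E = Vec K d

  E↔Fin : E ↔ Fin (q ℕ.^ d)
  E↔Fin = Finite.Vec↔Fin^ K↔Fin d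

  -- Multiplication by γ ≠ 0 is injective (no zero divisors) and hence, E being finite,
  -- surjective: γ has an inverse.
  ⋆-injective : ∀ (γ : E) → γ ≢ 0ᵛ → ∀ {x y} → γ ⋆ x ≡ γ ⋆ y → x ≡ y
  ⋆-injective γ γ≢0 {x} {y} e =
    ⊕-cancelʳ x y (⊖ y) (trans (no-zero-divisors (x ⊕ ⊖ y) γ[x-y]≡0) (sym (⊕-inverseʳ y)))
    where
      open NoZeroDivisors (Finite.≟-finite K↔Fin) irr γ γ≢0
      γ[x-y]≡0 : γ ⋆ (x ⊕ ⊖ y) ≡ 0ᵛ
      γ[x-y]≡0 = begin
        γ ⋆ (x ⊕ ⊖ y)       ≡⟨ ⋆-⊕ʳ γ x (⊖ y) ⟩
        γ ⋆ x ⊕ γ ⋆ (⊖ y)   ≡⟨ cong₂ _⊕_ e (⋆-·ʳ γ (- 1#) y) ⟩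
        γ ⋆ y ⊕ ⊖ (γ ⋆ y)   ≡⟨ ⊕-inverseʳ (γ ⋆ y) ⟩
        0ᵛ                  ∎

  ⋆-inverse : ∀ (γ : E) → γ ≢ 0ᵛ → ∃ λ δ → γ ⋆ δ ≡ one
  ⋆-inverse γ γ≢0 = Finite.injective⇒surjective E↔Fin (γ ⋆_) (⋆-injective γ γ≢0) one

  iterL-⋆ : ∀ j (γ y : E) → iterL j (γ ⋆ y) ≡ γ ⋆ iterL j y
  iterL-⋆ zero γ y = refl
  iterL-⋆ (suc j) γ y = trans (cong L (iterL-⋆ j γ y)) (sym (⋆-L γ (iterL j y)))

  L-lc : ∀ (a : Idx → K) (g : Idx → E) → L (lc a g) ≡ lc a (L ∘ g)
  L-lc = lc-linear L L-⊕ L-·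

  admissible : Vec E m → Idx → E
  admissible = D.admissible 𝔽 m n c

  module _ (v : Vec E m) (β : IsBasis 𝔽 m n (admissible v)) where
    b : Idx → E
    b = admissible v
    open IsBasis β

    SameMatrix : Vec E m → Set
    SameMatrix v′ = Σ (IsBasis 𝔽 m n (admissible v′)) λ β′ → ∀ k l → D.matrix 𝔽 c β′ k l ≡ D.matrix 𝔽 c β k l

    scale : E → Vec E m
    scale γ = map (γ ⋆_) v

    admissible-scale : ∀ γ l → admissible (scale γ) l ≡ γ ⋆ b l
    admissible-scale γ (j , i) =
      trans (cong (iterL (Fin.toℕ j)) (VP.lookup-map i (γ ⋆_) v)) (iterL-⋆ (Fin.toℕ j) γ (lookup v i))

    -- Every γ ≠ 0 gives one: γ·b is a basis (coordinates of x are those of γ⁻¹x w.r.t. b),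
    -- and since multiplication by γ commutes with α the matrix is unchanged.
    scale-sameMatrix : ∀ γ → γ ≢ 0ᵛ → SameMatrix (scale γ)
    scale-sameMatrix γ γ≢0 = β′ , same
      where
        γ⁻¹ = proj₁ (⋆-inverse γ γ≢0)
        γ⁻¹⋆γ⋆x : ∀ x → γ⁻¹ ⋆ γ ⋆ x ≡ x
        γ⁻¹⋆γ⋆x x = trans (sym (⋆-assoc γ⁻¹ γ x))
                   (trans (cong (_⋆ x) (trans (⋆-comm γ⁻¹ γ) (proj₂ (⋆-inverse γ γ≢0)))) (⋆-identityˡ x))
        γ⋆γ⁻¹⋆x : ∀ x → γ ⋆ γ⁻¹ ⋆ x ≡ x
        γ⋆γ⁻¹⋆x x = trans (sym (⋆-assoc γ γ⁻¹ x))
                     (trans (cong (_⋆ x) (proj₂ (⋆-inverse γ γ≢0))) (⋆-identityˡ x))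
        b′ = admissible (scale γ)
        lc-scale : ∀ a → lc a b′ ≡ γ ⋆ lc a b
        lc-scale a = trans (lc-congᵛ a (admissible-scale γ)) (sym (lc-linear (γ ⋆_) (⋆-⊕ʳ γ) (⋆-·ʳ γ) a b))
        β′ : IsBasis 𝔽 m n b′
        β′ = record
          { coord = λ x → coord (γ⁻¹ ⋆ x)
          ; spans = λ x → trans (lc-scale (coord (γ⁻¹ ⋆ x)))
                              (trans (cong (γ ⋆_) (spans (γ⁻¹ ⋆ x))) (γ⋆γ⁻¹⋆x x))
          ; unique = λ x a e → unique (γ⁻¹ ⋆ x) a
                       (trans (sym (γ⁻¹⋆γ⋆x (lc a b))) (cong (γ⁻¹ ⋆_) (trans (sym (lc-scale a)) e)))
          }
        same : ∀ k l → D.matrix 𝔽 c β′ k l ≡ D.matrix 𝔽 c β k l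
        same k l = cong (λ x → coord x k) (begin
          γ⁻¹ ⋆ L (b′ l)          ≡⟨ cong (λ u → γ⁻¹ ⋆ L u) (admissible-scale γ l) ⟩
          γ⁻¹ ⋆ L (γ ⋆ b l)       ≡⟨ cong (γ⁻¹ ⋆_) (sym (⋆-L γ (b l))) ⟩
          γ⁻¹ ⋆ γ ⋆ L (b l)       ≡⟨ γ⁻¹⋆γ⋆x (L (b l)) ⟩
          L (b l)               ∎)

    -- Conversely, for a basis b′ with the same matrix, the change of basis T : b ↦ b′
    -- commutes with α, hence is multiplication by γ = T 1, and v′ = γ v.
    module ChangeOfBasis {b′ : Idx → E} (β′ : IsBasis 𝔽 m n b′)
                         (same : ∀ k l → IsBasis.coord β′ (L (b′ l)) k ≡ coord (L (b l)) k) where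
      open Coordinates β

      T : E → E
      T x = lc (coord x) b′

      T-basis : ∀ l → T (b l) ≡ b′ l
      T-basis l = trans (lc-congᶜ b′ (coord-basis l)) (lc-δ l b′)

      T-commutesWithα : CommutesWithα T
      T-commutesWithα = record { hom-⊕ = T-⊕ ; hom-· = T-· ; hom-L = T-L }
        where
          T-⊕ : ∀ x y → T (x ⊕ y) ≡ T x ⊕ T y
          T-⊕ x y = trans (lc-congᶜ b′ (coord-⊕ x y)) (lc-⊕ (coord x) (coord y) b′)
          T-· : ∀ a x → T (a · x) ≡ a · T x
          T-· a x = trans (lc-congᶜ b′ (coord-· a x)) (lc-· a (coord x) b′)
          -- on basis vectors: T (α b_l) = α b′_l because both have the same coordinates
          T-Lb : ∀ l → T (L (b l)) ≡ L (b′ l)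
          T-Lb l = trans (lc-congᶜ b′ (λ k → sym (same k l))) (IsBasis.spans β′ (L (b′ l)))
          T-L : ∀ x → T (L x) ≡ L (T x)
          T-L x = begin
            T (L x)                   ≡⟨ cong (λ u → T (L u)) (sym (spans x)) ⟩
            T (L (lc (coord x) b))    ≡⟨ cong T (L-lc (coord x) b) ⟩
            T (lc (coord x) (L ∘ b))  ≡⟨ lc-linear T T-⊕ T-· (coord x) (L ∘ b) ⟩
            lc (coord x) (T ∘ L ∘ b)  ≡⟨ lc-congᵛ (coord x) T-Lb ⟩
            lc (coord x) (L ∘ b′)     ≡⟨ sym (L-lc (coord x) b′) ⟩
            L (T x)                   ∎

      T-is-⋆ : ∀ x → T x ≡ T one ⋆ x
      T-is-⋆ x = trans (commutesWithα⇒⋆ T-commutesWithα x) (⋆-comm x (T one))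

    sameMatrix-scale : ∀ v′ → SameMatrix v′ → Σ E λ γ → γ ≢ 0ᵛ × v′ ≡ scale γ
    sameMatrix-scale v′ (β′ , same) = T one , γ≢0 , v′≡γv
      where
        open ChangeOfBasis β′ same
        column : ∀ i → lookup v′ i ≡ T one ⋆ lookup v i
        column i = trans (sym (T-basis (Fin.zero , i))) (T-is-⋆ (lookup v i))
        v′≡γv : v′ ≡ scale (T one)
        v′≡γv = trans (sym (VP.tabulate∘lookup v′))
                  (trans (VP.tabulate-cong (λ i → trans (column i) (sym (VP.lookup-map i (T one ⋆_) v))))
                         (VP.tabulate∘lookup (scale (T one))))
        γ≢0 : T one ≢ 0ᵛ
        γ≢0 γ≡0 = Coordinates.basis≢0 β′ (Fin.zero , Fin.zero)
          (trans (column Fin.zero) (trans (cong (_⋆ lookup v Fin.zero) γ≡0) (⋆-zeroˡ {d} (lookup v Fin.zero))))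

    -- Distinct γ give distinct v′ = γ v, because v₁ = b_(0,0) ≠ 0 is not a zero divisor.
    scale-injective : ∀ {γ γ′} → scale γ ≡ scale γ′ → γ ≡ γ′
    scale-injective {γ} {γ′} e = ⋆-injective v₁ v₁≢0 (begin
      v₁ ⋆ γ     ≡⟨ ⋆-comm v₁ γ ⟩
      γ ⋆ v₁     ≡⟨ sym (VP.lookup-map Fin.zero (γ ⋆_) v) ⟩
      lookup (scale γ) Fin.zero   ≡⟨ cong (λ w → lookup w Fin.zero) e ⟩
      lookup (scale γ′) Fin.zero  ≡⟨ VP.lookup-map Fin.zero (γ′ ⋆_) v ⟩
      γ′ ⋆ v₁    ≡⟨ ⋆-comm γ′ v₁ ⟩
      v₁ ⋆ γ′    ∎)
      where
        v₁ = lookup v Fin.zero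
        v₁≢0 = Coordinates.basis≢0 β (Fin.zero , Fin.zero)

    count : Σ (List (Vec E m)) λ ls → Unique ls × L.length ls ≡ q ℕ.^ d ∸ 1 × (∀ v′ → (v′ ∈ ls) ⇔ SameMatrix v′)
    count = L.map scale units
          , UniqueP.map⁺ scale-injective (Finite.allExcept-unique E↔Fin 0ᵛ)
          , trans (length-map scale units) (Finite.allExcept-length E↔Fin 0ᵛ)
          , λ v′ → mk⇔ (listed⇒sameMatrix v′) (sameMatrix⇒listed v′)
      where
        units = Finite.allExcept E↔Fin 0ᵛ
        listed⇒sameMatrix : ∀ v′ → v′ ∈ L.map scale units → SameMatrix v′
        listed⇒sameMatrix v′ v′∈ with ∈-map⁻ scale v′∈
        ... | γ , γ∈ , refl = scale-sameMatrix γ (Finite.allExcept-∌ E↔Fin 0ᵛ γ γ∈)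
        sameMatrix⇒listed : ∀ v′ → SameMatrix v′ → v′ ∈ L.map scale units
        sameMatrix⇒listed v′ same with sameMatrix-scale v′ same
        ... | γ , γ≢0 , refl = ∈-map⁺ scale (Finite.∈-allExcept E↔Fin 0ᵛ γ γ≢0)

open import Defs
open import Data.Nat using (ℕ; _*_; _^_; _∸_; _≤_)
open import Data.Vec using (Vec)
open import Data.List using (List; length)
open import Data.List.Membership.Propositional using (_∈_)
open import Data.List.Relation.Unary.Unique.Propositional using (Unique)
open import Data.Product using (Σ; ∃; _×_)
open import Data.Fin using (Fin)
open import Function.Bundles using (_↔_; _⇔_)
open import Relation.Binary.PropositionalEquality using (_≡_)

lemma5p2 : (F : Field) (q : ℕ) → IsPrimePower q → (Field.Carrier F ↔ Fin q)
    → (m n : ℕ) → 1 ≤ m → 1 ≤ n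
    → (c : Vec (Field.Carrier F) (m * n)) → Irreducible F (monicPoly F c)
    → (v : Vec (Ext F (m * n)) m) → (β : IsBasis F m n (admissible F m n c v))
    → Σ (List (Vec (Ext F (m * n)) m)) λ ls → Unique ls × length ls ≡ q ^ (m * n) ∸ 1
    × (∀ v′ → (v′ ∈ ls) ⇔ Σ (IsBasis F m n (admissible F m n c v′)) λ β′ → ∀ k l → matrix F c β′ k l ≡ matrix F c β k l)
lemma5p2 F q _ K↔Fin (suc m′) (suc n′) (s≤s z≤n) (s≤s z≤n) c irr v β =
  AdmissibleBases.count F K↔Fin m′ n′ c irr v β
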